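{- Let $\varepsilon\in\{ -1,1\}$, let $L=(k+3)\sigma^2-\varepsilon(2k+3)(1+2z)\sigma+k$, and for $s\in\mathbb{N}$ let $x_{s+2}(k)=2(2k+3)^s(k+1)(k+2)$. For $z\in\mathbb{Z}$ let $F_k(z)$ denote either $\varepsilon^kS_k(z)$ for all $k$, or $\varepsilon^k s_k(z)$ for all $k$. Then for any $z\in\mathbb{Z}$ and $n,s\in\mathbb{N}$ with $n>1$, \[ \sum_{k=0}^{n-1}L^{\ast}(x_{s+2}(k))F_k(z)\equiv 0\pmod{2n(n^2-1)}. \]
   Context: $\mathbb{N}=\{0,1,2,\dots\}$. $\sigma$ is the shift operator, $\sigma F(k)=F(k+1)$. For $L=\sum_{i=0}^{2}a_i(k)\sigma^i$ with $a_2(k)=k+3$, $a_1(k)=-\varepsilon(2k+3)(1+2z)$, $a_0(k)=k$, the adjoint is $L^*(x(k))=\sum_{i=0}^{2}a_i(k-i)x(k-i)$. The large Schröder polynomials are $S_n(z)=\sum_{j=0}^{n}\binom{n}{j}\binom{n+j}{j}\frac{1}{j+1}z^j$ ($n\ge0$); the little Schröder polynomials are $s_0(z)=0$ and $s_n(z)=\sum_{j=1}^{n}\frac{1}{n}\binom{n}{j}\binom{n}{j-1}z^{j-1}(z+1)^{n-j}$ ($n\ge1$). -}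

module Defs where

open import Data.Nat as ℕ using (ℕ; zero; suc)
open import Data.Nat.Combinatorics using (_C_)
open import Data.Integer using (ℤ; +_; _+_; _*_; _-_; -_; _^_)

sumTo : ℕ → (ℕ → ℤ) → ℤ
sumTo zero    f = + 0
sumTo (suc n) f = sumTo n f + f n

-- Σ_{j=a}^{b} f j  (computed as Σ_{i=0}^{b-a} f (a+i); empty if b < a)
sumFromTo : ℕ → ℕ → (ℕ → ℤ) → ℤ
sumFromTo a b f = sumTo (suc b ℕ.∸ a) (λ i → f (a ℕ.+ i))

-- Large Schröder polynomial S_n(z) = Σ_{j=0}^n C(n,j) C(n+j,j) /(j+1) z^j
-- (the ℕ-division is exact)
largeS : ℕ → ℤ → ℤ
largeS n z = sumFromTo 0 n (λ j →
  + (((n C j) ℕ.* ((n ℕ.+ j) C j)) ℕ./ suc j) * (z ^ j))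

-- Little Schröder polynomial s_0 = 0,
-- s_n(z) = Σ_{j=1}^n (1/n) C(n,j) C(n,j-1) z^(j-1) (z+1)^(n-j)   (n ≥ 1)
-- (the ℕ-division is exact)
littleS : ℕ → ℤ → ℤ
littleS zero    z = + 0
littleS (suc m) z = sumFromTo 1 (suc m) (λ j →
  + (((suc m C j) ℕ.* (suc m C (j ℕ.∸ 1))) ℕ./ suc m)
    * ((z ^ (j ℕ.∸ 1)) * ((z + + 1) ^ (suc m ℕ.∸ j))))

-- Coefficients of L = a₂(k) σ² + a₁(k) σ + a₀(k), as functions of k ∈ ℤ
a₂ : ℤ → ℤ
a₂ k = k + + 3

a₁ : (ε z : ℤ) → ℤ → ℤ
a₁ ε z k = - (ε * ((+ 2 * k + + 3) * (+ 1 + + 2 * z)))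

a₀ : ℤ → ℤ
a₀ k = k

Ladj : (ε z : ℤ) → (ℤ → ℤ) → ℤ → ℤ
Ladj ε z x k = a₀ k * x k + a₁ ε z (k - + 1) * x (k - + 1)
             + a₂ (k - + 2) * x (k - + 2)

xs2 : ℕ → ℤ → ℤ
xs2 s k = + 2 * ((+ 2 * k + + 3) ^ s) * (k + + 1) * (k + + 2)

module Submission where

-- The sum is a summation by parts: L* is the adjoint of L and x_{s+2} vanishes at k = −1, −2, so
-- Σ_{k<n} L*(x)(k) F_k equals Σ_{k<n} x(k) (L F)(k) plus a boundary term, and both families F satisfy
-- L F = 0. For ε = 1 this is the three-term recurrence k G_k − (2k+3)(1+2z) G_{k+1} + (k+3) G_{k+2} = 0
-- of the Schröder polynomials, proved coefficientwise after writing S_k and s_{k+1} as homogeneous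
-- polynomials in (z, 1) and (z, z + 1); the coefficient identities are ℤ-linear combinations of the
-- ratio relations between neighbouring binomial coefficients. The twist ε^k carries the recurrence
-- over to general ε since ε² = 1. Finally the boundary term is
-- (n−1) x(n−1) F_{n−1} − (n+1) x(n−2) F_n, and the factors (k+1)(k+2) of x_{s+2} make it a multiple
-- of 2(n−1)n(n+1).

open import Defs
open import Data.Nat as ℕ using (ℕ; zero; suc; _∸_; _>_)
import Data.Nat.Properties as ℕₚ
open import Data.Nat.Combinatorics using (_C_; k>n⇒nCk≡0; nC1≡n; nCk+nC[k+1]≡[n+1]C[k+1])
open import Data.Nat.DivMod using (m*[n/m]≡n)
open import Data.Integer using (ℤ; +_; _+_; _*_; _-_; -_; _^_)
import Data.Integer.Properties as ℤₚ
open import Data.Integer.Divisibility using (_∣_)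
import Data.Integer.Divisibility.Signed as Signed
open import Data.Nat.Divisibility using (_∣0)
open import Data.Integer.Tactic.RingSolver using (solve-∀)
open import Data.List using (List; []; _∷_)
open import Data.List.Relation.Unary.All using (All; []; _∷_)
open import Data.Product using (_×_; _,_; proj₁)
open import Data.Sum using (_⊎_; inj₁; inj₂)
import Algebra.Properties.CommutativeSemigroup ℤₚ.+-commutativeSemigroup as +-CS
import Algebra.Properties.CommutativeSemigroup ℤₚ.*-commutativeSemigroup as *-CS
open import Relation.Binary.PropositionalEquality using (_≡_; refl; sym; trans; cong; cong₂; subst; module ≡-Reasoning)

cancel-term : ∀ {d : ℤ} r l {a b : ℤ} → d ≡ r + l * (a - b) → a ≡ b → d ≡ r
cancel-term {d} r l {a} d≡ refl = begin
  d                 ≡⟨ d≡ ⟩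
  r + l * (a - a)   ≡⟨ cong (λ t → r + l * t) (ℤₚ.+-inverseʳ a) ⟩
  r + l * + 0       ≡⟨ cong (λ t → r + t) (ℤₚ.*-zeroʳ l) ⟩
  r + + 0           ≡⟨ ℤₚ.+-identityʳ r ⟩
  r                 ∎
  where open ≡-Reasoning

linear-combination₁ : ∀ {x y a₁ b₁ : ℤ} l₁ →
  x - y ≡ l₁ * (a₁ - b₁) → a₁ ≡ b₁ → x ≡ y
linear-combination₁ {x} {y} l₁ e h₁ =
  ℤₚ.i-j≡0⇒i≡j x y (cancel-term (+ 0) l₁ (trans e (sym (ℤₚ.+-identityˡ _))) h₁)

linear-combination₂ : ∀ {x y a₁ b₁ a₂ b₂ : ℤ} l₁ l₂ →
  x - y ≡ l₁ * (a₁ - b₁) + l₂ * (a₂ - b₂) → a₁ ≡ b₁ → a₂ ≡ b₂ → x ≡ y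
linear-combination₂ l₁ l₂ e h₁ h₂ = linear-combination₁ l₁ (cancel-term _ l₂ e h₂) h₁

linear-combination₃ : ∀ {x y a₁ b₁ a₂ b₂ a₃ b₃ : ℤ} l₁ l₂ l₃ →
  x - y ≡ l₁ * (a₁ - b₁) + l₂ * (a₂ - b₂) + l₃ * (a₃ - b₃) →
  a₁ ≡ b₁ → a₂ ≡ b₂ → a₃ ≡ b₃ → x ≡ y
linear-combination₃ l₁ l₂ l₃ e h₁ h₂ h₃ =
  linear-combination₂ l₁ l₂ (cancel-term _ l₃ e h₃) h₁ h₂

linear-combination₄ : ∀ {x y a₁ b₁ a₂ b₂ a₃ b₃ a₄ b₄ : ℤ} l₁ l₂ l₃ l₄ →
  x - y ≡ l₁ * (a₁ - b₁) + l₂ * (a₂ - b₂) + l₃ * (a₃ - b₃) + l₄ * (a₄ - b₄) →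
  a₁ ≡ b₁ → a₂ ≡ b₂ → a₃ ≡ b₃ → a₄ ≡ b₄ → x ≡ y
linear-combination₄ l₁ l₂ l₃ l₄ e h₁ h₂ h₃ h₄ =
  linear-combination₃ l₁ l₂ l₃ (cancel-term _ l₄ e h₄) h₁ h₂ h₃

linear-combination₅ : ∀ {x y a₁ b₁ a₂ b₂ a₃ b₃ a₄ b₄ a₅ b₅ : ℤ} l₁ l₂ l₃ l₄ l₅ →
  x - y ≡ l₁ * (a₁ - b₁) + l₂ * (a₂ - b₂) + l₃ * (a₃ - b₃) + l₄ * (a₄ - b₄) + l₅ * (a₅ - b₅) →
  a₁ ≡ b₁ → a₂ ≡ b₂ → a₃ ≡ b₃ → a₄ ≡ b₄ → a₅ ≡ b₅ → x ≡ y
linear-combination₅ l₁ l₂ l₃ l₄ l₅ e h₁ h₂ h₃ h₄ h₅ =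
  linear-combination₄ l₁ l₂ l₃ l₄ (cancel-term _ l₅ e h₅) h₁ h₂ h₃ h₄

exact-quotient : ∀ {m d} (q : ℤ) → + suc d * q ≡ + m → + suc d * + (m ℕ./ suc d) ≡ + m
exact-quotient {m} {d} q d*q≡m =
  trans (sym (ℤₚ.pos-* (suc d) _)) (cong +_ (m*[n/m]≡n (Signed.∣⇒∣ᵤ (Signed.divides q m≡q*d))))
  where
  m≡q*d : + m ≡ q * + suc d
  m≡q*d = trans (sym d*q≡m) (ℤₚ.*-comm (+ suc d) q)

-- Binomial coefficients

binom : ℕ → ℕ → ℤ
binom n k = + (n C k)

binom-pascal : ∀ n k → binom (suc n) (suc k) ≡ binom n k + binom n (suc k)
binom-pascal n k = trans (cong +_ (sym (nCk+nC[k+1]≡[n+1]C[k+1] n k))) (ℤₚ.pos-+ (n C k) _)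

binom-absorption : ∀ n k → + suc k * binom (suc n) (suc k) ≡ + suc n * binom n k
binom-absorption n zero = trans (ℤₚ.*-identityˡ _) (trans (cong +_ (nC1≡n (suc n))) (sym (ℤₚ.*-identityʳ _)))
binom-absorption zero (suc k) = ℤₚ.*-zeroʳ (+ suc (suc k))
binom-absorption (suc n) (suc k) =
  linear-combination₄ (+ 2 + + k) (+ 1) (+ 1) (- (+ 1 + + n))
    (certificate (+ n) (+ k) (binom (suc (suc n)) (suc (suc k))) (binom (suc n) (suc k))
                 (binom (suc n) (suc (suc k))) (binom n k) (binom n (suc k)))
    (binom-pascal (suc n) (suc k)) (binom-absorption n (suc k)) (binom-absorption n k) (binom-pascal n k)
  where
  certificate : ∀ (N K X P Q R S : ℤ) →
    (+ 2 + K) * X - (+ 2 + N) * P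
      ≡ (+ 2 + K) * (X - (P + Q)) + + 1 * ((+ 2 + K) * Q - (+ 1 + N) * S)
        + + 1 * ((+ 1 + K) * P - (+ 1 + N) * R) + (- (+ 1 + N)) * (P - (R + S))
  certificate = solve-∀

binom-succ : ∀ n k → + suc k * binom n (suc k) ≡ (+ n - + k) * binom n k
binom-succ n k =
  linear-combination₂ (- + suc k) (+ 1) (certificate (+ n) (+ k) (binom (suc n) (suc k)) (binom n k) (binom n (suc k)))
    (binom-pascal n k) (binom-absorption n k)
  where
  certificate : ∀ (N K X P Q : ℤ) →
    (+ 1 + K) * Q - (N - K) * P ≡ (- (+ 1 + K)) * (X - (P + Q)) + + 1 * ((+ 1 + K) * X - (+ 1 + N) * P)
  certificate = solve-∀

binom-row-succ : ∀ n k → (+ suc n - + k) * binom (suc n) k ≡ + suc n * binom n k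
binom-row-succ n k = trans (sym (binom-succ (suc n) k)) (binom-absorption n k)

-- Coefficients of the Schröder polynomials

shift : (ℕ → ℤ) → ℕ → ℤ
shift f zero    = + 0
shift f (suc i) = f i

largeCoeff : ℕ → ℕ → ℤ
largeCoeff n j = + (((n C j) ℕ.* ((n ℕ.+ j) C j)) ℕ./ suc j)

largeCoeff-spec : ∀ n j → + suc j * largeCoeff n j ≡ binom n j * binom (n ℕ.+ j) j
largeCoeff-spec n j = trans (exact-quotient q (trans (+suc-j*q) (sym (ℤₚ.pos-* (n C j) _)))) (ℤₚ.pos-* (n C j) _)
  where
  A = binom n j
  A′ = binom n (suc j)
  D = binom (n ℕ.+ j) j
  D′ = binom (n ℕ.+ j) (suc j)
  q = A * D - A * D′ + A′ * D
  certificate : ∀ (J N A A′ D D′ : ℤ) →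
    (+ 1 + J) * (A * D - A * D′ + A′ * D) - A * D
      ≡ (- A) * ((+ 1 + J) * D′ - (N + J - J) * D) + D * ((+ 1 + J) * A′ - (N - J) * A)
  certificate = solve-∀
  +suc-j*q : + suc j * q ≡ A * D
  +suc-j*q = linear-combination₂ (- A) D (certificate (+ j) (+ n) A A′ D D′) (binom-succ (n ℕ.+ j) j) (binom-succ n j)

largeCoeff-vanishes : ∀ {n j} → n ℕ.< j → largeCoeff n j ≡ + 0
largeCoeff-vanishes {n} {j} n<j = cong (λ t → + ((t ℕ.* ((n ℕ.+ j) C j)) ℕ./ suc j)) (k>n⇒nCk≡0 n<j)

largeCoeff-row : ∀ n j → (+ suc n - + j) * largeCoeff (suc n) j ≡ (+ suc n + + j) * largeCoeff n j
largeCoeff-row n j = ℤₚ.*-cancelˡ-≡ (+ suc j) _ _ (ℤₚ.*-cancelˡ-≡ (+ suc n) _ _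
  (linear-combination₄ ((+ 1 + N) * (+ 1 + N - J)) ((+ 1 + N) * binom (suc (n ℕ.+ j)) j)
    ((+ 1 + N) * binom n j) (- ((+ 1 + N) * (+ 1 + N + J)))
    (certificate N J (largeCoeff (suc n) j) (largeCoeff n j)
      (binom (suc n) j) (binom (suc (n ℕ.+ j)) j) (binom n j) (binom (n ℕ.+ j) j))
    (largeCoeff-spec (suc n) j) (binom-row-succ n j) (binom-row-succ (n ℕ.+ j) j) (largeCoeff-spec n j)))
  where
  N = + n
  J = + j
  certificate : ∀ (N J X Y Bn1 Bm1 Bnj Bm : ℤ) →
    (+ 1 + N) * ((+ 1 + J) * ((+ 1 + N - J) * X)) - (+ 1 + N) * ((+ 1 + J) * ((+ 1 + N + J) * Y))
    ≡ (+ 1 + N) * (+ 1 + N - J) * ((+ 1 + J) * X - Bn1 * Bm1)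
      + (+ 1 + N) * Bm1 * ((+ 1 + N - J) * Bn1 - (+ 1 + N) * Bnj)
      + (+ 1 + N) * Bnj * ((+ 1 + N + J - J) * Bm1 - (+ 1 + N + J) * Bm)
      + (- ((+ 1 + N) * (+ 1 + N + J))) * ((+ 1 + J) * Y - Bnj * Bm)
  certificate = solve-∀

largeCoeff-diagonal : ∀ n j →
  + j * (+ 1 + + j) * largeCoeff (suc n) j ≡ (+ 1 + + n + + j) * (+ n + + j) * shift (largeCoeff n) j
largeCoeff-diagonal n zero =
  trans (ℤₚ.*-zeroˡ (largeCoeff (suc n) 0)) (sym (ℤₚ.*-zeroʳ ((+ 1 + + n + + 0) * (+ n + + 0))))
largeCoeff-diagonal n (suc i) = ℤₚ.*-cancelˡ-≡ (+ suc i) _ _ (ℤₚ.*-cancelˡ-≡ (+ suc n) _ _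
  (linear-combination₅ ((+ 1 + N) * (+ 1 + I) * (+ 1 + I)) ((+ 1 + N) * (+ 1 + I) * V) ((+ 1 + N) * (+ 1 + N) * Bni)
    ((+ 1 + N) * Bni * (+ 1 + (+ 1 + N + I))) (- ((+ 1 + N) * (+ 1 + (+ 1 + N + I)) * (+ 1 + N + I)))
    (certificate N I (largeCoeff (suc n) (suc i)) (largeCoeff n i) (binom (suc n) (suc i)) V Bni W Bnii)
    spec-suc (binom-absorption n i) absorption-suc (binom-row-succ (n ℕ.+ i) i) (largeCoeff-spec n i)))
  where
  N = + n
  I = + i
  V = binom (suc (suc (n ℕ.+ i))) (suc i)
  W = binom (suc (n ℕ.+ i)) i
  Bni = binom n i
  Bnii = binom (n ℕ.+ i) i
  spec-suc : + suc (suc i) * largeCoeff (suc n) (suc i) ≡ binom (suc n) (suc i) * V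
  spec-suc = subst (λ t → + suc (suc i) * largeCoeff (suc n) (suc i) ≡ binom (suc n) (suc i) * binom (suc t) (suc i))
                   (ℕₚ.+-suc n i) (largeCoeff-spec (suc n) (suc i))
  absorption-suc : + suc i * V ≡ + suc (suc (n ℕ.+ i)) * W
  absorption-suc = subst (λ t → + suc i * binom (suc t) (suc i) ≡ + suc t * binom t i)
                         (ℕₚ.+-suc n i) (binom-absorption (n ℕ.+ suc i) i)
  certificate : ∀ (N I X Y B1 V Bni W Bnii : ℤ) →
    (+ 1 + N) * ((+ 1 + I) * ((+ 1 + I) * (+ 1 + (+ 1 + I)) * X))
      - (+ 1 + N) * ((+ 1 + I) * ((+ 1 + N + (+ 1 + I)) * (N + (+ 1 + I)) * Y))
    ≡ (+ 1 + N) * (+ 1 + I) * (+ 1 + I) * ((+ 1 + (+ 1 + I)) * X - B1 * V)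
      + (+ 1 + N) * (+ 1 + I) * V * ((+ 1 + I) * B1 - (+ 1 + N) * Bni)
      + (+ 1 + N) * (+ 1 + N) * Bni * ((+ 1 + I) * V - (+ 1 + (+ 1 + N + I)) * W)
      + (+ 1 + N) * Bni * (+ 1 + (+ 1 + N + I)) * ((+ 1 + N + I - I) * W - (+ 1 + N + I) * Bnii)
      + (- ((+ 1 + N) * (+ 1 + (+ 1 + N + I)) * (+ 1 + N + I))) * ((+ 1 + I) * Y - Bni * Bnii)
  certificate = solve-∀

largeCoeff-recurrence : ∀ k j →
  (+ 3 + + k) * largeCoeff (suc (suc k)) j
    - (+ 3 + + 2 * + k) * (largeCoeff (suc k) j + + 2 * shift (largeCoeff (suc k)) j)
    + + k * largeCoeff k j ≡ + 0
largeCoeff-recurrence k j = ℤₚ.*-cancelˡ-≡ (+ 1 + K + J) _ _ (ℤₚ.*-cancelˡ-≡ (+ 1 + (+ 1 + K) + J) _ _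
  (linear-combination₃ ((+ 3 + + 2 * K) * (+ 1 + K + J) - K * (+ 1 + K - J)) (- (K * (+ 1 + (+ 1 + K) + J)))
    (+ 2 * (+ 3 + + 2 * K))
    (certificate K J (largeCoeff (suc (suc k)) j) (largeCoeff (suc k) j) (shift (largeCoeff (suc k)) j) (largeCoeff k j))
    (largeCoeff-row (suc k) j) (largeCoeff-row k j) (largeCoeff-diagonal (suc k) j)))
  where
  K = + k
  J = + j
  certificate : ∀ (K J X c1 cs1 c0 : ℤ) →
    (+ 1 + (+ 1 + K) + J) * ((+ 1 + K + J) * ((+ 3 + K) * X - (+ 3 + + 2 * K) * (c1 + + 2 * cs1) + K * c0))
      - (+ 1 + (+ 1 + K) + J) * ((+ 1 + K + J) * + 0)
    ≡ ((+ 3 + + 2 * K) * (+ 1 + K + J) - K * (+ 1 + K - J)) * ((+ 1 + (+ 1 + K) - J) * X - (+ 1 + (+ 1 + K) + J) * c1)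
      + (- (K * (+ 1 + (+ 1 + K) + J))) * ((+ 1 + K - J) * c1 - (+ 1 + K + J) * c0)
      + (+ 2 * (+ 3 + + 2 * K)) * (J * (+ 1 + J) * X - (+ 1 + (+ 1 + K) + J) * (+ 1 + K + J) * cs1)
  certificate = solve-∀

littleCoeff : ℕ → ℕ → ℤ
littleCoeff p i = + (((suc p C suc i) ℕ.* (suc p C i)) ℕ./ suc p)

littleCoeff-spec : ∀ p i → + suc p * littleCoeff p i ≡ binom (suc p) (suc i) * binom (suc p) i
littleCoeff-spec p zero =
  trans (exact-quotient (+ 1) (cong (λ t → + (t ℕ.* 1)) (sym (nC1≡n (suc p)))))
        (ℤₚ.pos-* (suc p C 1) 1)
littleCoeff-spec p (suc i) =
  trans (exact-quotient q (trans +suc-p*q (sym (ℤₚ.pos-* (suc p C suc (suc i)) _))))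
        (ℤₚ.pos-* (suc p C suc (suc i)) _)
  where
  P = + p
  I = + i
  A = binom p i
  A′ = binom p (suc i)
  A″ = binom p (suc (suc i))
  q = A′ * A′ - A * A″
  certificate : ∀ (P I A A′ A″ : ℤ) →
    (+ 1 + I) * ((+ 1 + I) * ((+ 2 + I) * ((+ 1 + P) * (A′ * A′ - A * A″))))
    - (+ 1 + I) * ((+ 1 + I) * ((+ 2 + I) * ((A′ + A″) * (A + A′))))
    ≡ (+ 1 + I) * (+ 1 + I) * (+ 1 + P) * A′ * ((+ 1 + I) * A′ - (P - I) * A)
      + (- ((+ 1 + I) * (+ 1 + I) * ((+ 2 + P) * A + A′))) * ((+ 2 + I) * A″ - (P - (+ 1 + I)) * A′)
  certificate = solve-∀
  +suc-p*q : + suc p * q ≡ binom (suc p) (suc (suc i)) * binom (suc p) (suc i)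
  +suc-p*q = trans
    (ℤₚ.*-cancelˡ-≡ (+ suc (suc i)) _ _ (ℤₚ.*-cancelˡ-≡ (+ suc i) _ _ (ℤₚ.*-cancelˡ-≡ (+ suc i) _ _
      (linear-combination₂ ((+ 1 + I) * (+ 1 + I) * (+ 1 + P) * A′) (- ((+ 1 + I) * (+ 1 + I) * ((+ 2 + P) * A + A′))) (certificate P I A A′ A″) (binom-succ p i) (binom-succ p (suc i))))))
    (sym (cong₂ _*_ (binom-pascal p (suc i)) (binom-pascal p i)))

littleCoeff-vanishes : ∀ {p i} → p ℕ.< i → littleCoeff p i ≡ + 0
littleCoeff-vanishes {p} {i} p<i = cong (λ t → + ((t ℕ.* (suc p C i)) ℕ./ suc p)) (k>n⇒nCk≡0 (ℕ.s≤s p<i))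

littleCoeff-row : ∀ p i →
  littleCoeff p i * ((+ 1 + + p) * (+ 2 + + p)) ≡ (+ 1 + + p - + i) * (+ 2 + + p - + i) * littleCoeff (suc p) i
littleCoeff-row p i = ℤₚ.*-cancelˡ-≡ (+ suc (suc p)) _ _
  (linear-combination₄ (P₂ * P₂) (- ((+ 1 + P - I) * (P₂ - I))) (- ((P₂ - I) * B₂₀)) (- (P₂ * B₁₁))
    (certificate P I (littleCoeff (suc p) i) (littleCoeff p i) B₂₁ B₂₀ B₁₁ B₁₀)
    (littleCoeff-spec p i) (littleCoeff-spec (suc p) i) (binom-row-succ (suc p) (suc i)) (binom-row-succ (suc p) i))
  where
  P = + p
  I = + i
  P₂ = + 2 + P
  B₂₁ = binom (suc (suc p)) (suc i)
  B₂₀ = binom (suc (suc p)) i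
  B₁₁ = binom (suc p) (suc i)
  B₁₀ = binom (suc p) i
  certificate : ∀ (P I X Y B₂₁ B₂₀ B₁₁ B₁₀ : ℤ) →
    (+ 2 + P) * (Y * ((+ 1 + P) * (+ 2 + P))) - (+ 2 + P) * ((+ 1 + P - I) * (+ 2 + P - I) * X)
    ≡ (+ 2 + P) * (+ 2 + P) * ((+ 1 + P) * Y - B₁₁ * B₁₀)
      + (- ((+ 1 + P - I) * (+ 2 + P - I))) * ((+ 2 + P) * X - B₂₁ * B₂₀)
      + (- ((+ 2 + P - I) * B₂₀)) * ((+ 2 + P - (+ 1 + I)) * B₂₁ - (+ 2 + P) * B₁₁)
      + (- ((+ 2 + P) * B₁₁)) * ((+ 2 + P - I) * B₂₀ - (+ 2 + P) * B₁₀)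
  certificate = solve-∀

littleCoeff-diagonal : ∀ p i →
  (+ 1 + + i) * + i * littleCoeff (suc p) i ≡ (+ 1 + + p) * (+ 2 + + p) * shift (littleCoeff p) i
littleCoeff-diagonal p zero =
  trans (ℤₚ.*-zeroˡ (littleCoeff (suc p) 0)) (sym (ℤₚ.*-zeroʳ ((+ 1 + + p) * (+ 2 + + p))))
littleCoeff-diagonal p (suc i) = ℤₚ.*-cancelˡ-≡ (+ suc p) _ _ (ℤₚ.*-cancelˡ-≡ (+ suc (suc p)) _ _
  (linear-combination₄ ((+ 1 + P) * (+ 2 + I) * (+ 1 + I)) ((+ 1 + P) * (+ 1 + I) * B₂₁)
    ((+ 1 + P) * (+ 2 + P) * B₁₁) (- ((+ 1 + P) * (+ 2 + P) * (+ 2 + P)))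
    (certificate P I (littleCoeff (suc p) (suc i)) (littleCoeff p i) B₂₂ B₂₁ B₁₁ B₁₀)
    (littleCoeff-spec (suc p) (suc i)) (binom-absorption (suc p) (suc i)) (binom-absorption (suc p) i)
    (littleCoeff-spec p i)))
  where
  P = + p
  I = + i
  B₂₂ = binom (suc (suc p)) (suc (suc i))
  B₂₁ = binom (suc (suc p)) (suc i)
  B₁₁ = binom (suc p) (suc i)
  B₁₀ = binom (suc p) i
  certificate : ∀ (P I X Y B₂₂ B₂₁ B₁₁ B₁₀ : ℤ) →
    (+ 2 + P) * ((+ 1 + P) * ((+ 2 + I) * (+ 1 + I) * X)) - (+ 2 + P) * ((+ 1 + P) * ((+ 1 + P) * (+ 2 + P) * Y))
    ≡ (+ 1 + P) * (+ 2 + I) * (+ 1 + I) * ((+ 2 + P) * X - B₂₂ * B₂₁)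
      + (+ 1 + P) * (+ 1 + I) * B₂₁ * ((+ 2 + I) * B₂₂ - (+ 2 + P) * B₁₁)
      + (+ 1 + P) * (+ 2 + P) * B₁₁ * ((+ 1 + I) * B₂₁ - (+ 2 + P) * B₁₀)
      + (- ((+ 1 + P) * (+ 2 + P) * (+ 2 + P))) * ((+ 1 + P) * Y - B₁₁ * B₁₀)
  certificate = solve-∀

littleCoeff-diagonal₂ : ∀ p i →
  + i * (+ i - + 1) * shift (littleCoeff (suc p)) i ≡ (+ 1 + + p) * (+ 2 + + p) * shift (shift (littleCoeff p)) i
littleCoeff-diagonal₂ p zero = trans (ℤₚ.*-zeroˡ (shift (littleCoeff (suc p)) 0)) (sym (ℤₚ.*-zeroʳ ((+ 1 + + p) * (+ 2 + + p))))
littleCoeff-diagonal₂ p (suc i) = littleCoeff-diagonal p i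

littleCoeff-recurrence : ∀ q i →
  (+ 4 + + q) * littleCoeff (suc (suc q)) i
    - (+ 5 + + 2 * + q) * (shift (littleCoeff (suc q)) i + littleCoeff (suc q) i)
    + (+ 1 + + q) * (littleCoeff q i - + 2 * shift (littleCoeff q) i + shift (shift (littleCoeff q)) i) ≡ + 0
littleCoeff-recurrence q i =
  ℤₚ.*-cancelˡ-≡ (+ 2 + Q) _ _ (ℤₚ.*-cancelˡ-≡ (+ 1 + Q) _ _ (ℤₚ.*-cancelˡ-≡ (+ 3 + Q) _ _ (ℤₚ.*-cancelˡ-≡ (+ 2 + Q) _ _
    (linear-combination₅
      (- ((+ 5 + + 2 * Q) * ((+ 1 + Q) * (+ 2 + Q))) + (+ 1 + Q) * (+ 1 + Q - I) * (+ 2 + Q - I) - + 2 * (+ 1 + Q) * (+ 1 + I) * I)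
      ((+ 5 + + 2 * Q) * ((+ 1 + Q) * (+ 2 + Q)) - (+ 1 + Q) * I * (I - + 1))
      ((+ 1 + Q) * ((+ 2 + Q) * (+ 3 + Q)))
      (+ 2 * (+ 1 + Q) * ((+ 2 + Q) * (+ 3 + Q)))
      (- ((+ 1 + Q) * ((+ 2 + Q) * (+ 3 + Q))))
      (certificate Q I (e (suc (suc q))) (e (suc q)) (shift (littleCoeff (suc q)) i) (e q) (shift (littleCoeff q) i)
                   (shift (shift (littleCoeff q)) i))
      (littleCoeff-row (suc q) i) (littleCoeff-diagonal (suc q) i) (littleCoeff-row q i) (littleCoeff-diagonal q i)
      (littleCoeff-diagonal₂ q i)))))
  where
  Q = + q
  I = + i
  e : ℕ → ℤ
  e p = littleCoeff p i
  certificate : ∀ (Q I X e₁ s₁ e₀ s₀ ss₀ : ℤ) →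
    (+ 2 + Q) * ((+ 3 + Q) * ((+ 1 + Q) * ((+ 2 + Q) *
      ((+ 4 + Q) * X - (+ 5 + + 2 * Q) * (s₁ + e₁) + (+ 1 + Q) * (e₀ - + 2 * s₀ + ss₀)))))
    - (+ 2 + Q) * ((+ 3 + Q) * ((+ 1 + Q) * ((+ 2 + Q) * + 0)))
    ≡ (- ((+ 5 + + 2 * Q) * ((+ 1 + Q) * (+ 2 + Q))) + (+ 1 + Q) * (+ 1 + Q - I) * (+ 2 + Q - I) - + 2 * (+ 1 + Q) * (+ 1 + I) * I)
         * (e₁ * ((+ 2 + Q) * (+ 3 + Q)) - (+ 2 + Q - I) * (+ 3 + Q - I) * X)
      + ((+ 5 + + 2 * Q) * ((+ 1 + Q) * (+ 2 + Q)) - (+ 1 + Q) * I * (I - + 1))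
         * ((+ 1 + I) * I * X - (+ 2 + Q) * (+ 3 + Q) * s₁)
      + (+ 1 + Q) * ((+ 2 + Q) * (+ 3 + Q))
         * (e₀ * ((+ 1 + Q) * (+ 2 + Q)) - (+ 1 + Q - I) * (+ 2 + Q - I) * e₁)
      + + 2 * (+ 1 + Q) * ((+ 2 + Q) * (+ 3 + Q))
         * ((+ 1 + I) * I * e₁ - (+ 1 + Q) * (+ 2 + Q) * s₀)
      + (- ((+ 1 + Q) * ((+ 2 + Q) * (+ 3 + Q))))
         * (I * (I - + 1) * s₁ - (+ 1 + Q) * (+ 2 + Q) * ss₀)
  certificate = solve-∀

-- Homogeneous polynomials

sumTo-cong : ∀ n {f g : ℕ → ℤ} → (∀ i → i ℕ.< n → f i ≡ g i) → sumTo n f ≡ sumTo n g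
sumTo-cong zero    f≗g = refl
sumTo-cong (suc n) f≗g = cong₂ _+_ (sumTo-cong n (λ i i<n → f≗g i (ℕₚ.m<n⇒m<1+n i<n))) (f≗g n ℕₚ.≤-refl)

sumTo-zero : ∀ n {f : ℕ → ℤ} → (∀ i → f i ≡ + 0) → sumTo n f ≡ + 0
sumTo-zero zero    f≗0 = refl
sumTo-zero (suc n) f≗0 = cong₂ _+_ (sumTo-zero n f≗0) (f≗0 n)

sumTo-+ : ∀ n (f g : ℕ → ℤ) → sumTo n f + sumTo n g ≡ sumTo n (λ i → f i + g i)
sumTo-+ zero    f g = refl
sumTo-+ (suc n) f g = trans (+-CS.interchange (sumTo n f) (f n) (sumTo n g) (g n)) (cong (_+ (f n + g n)) (sumTo-+ n f g))

*-distribˡ-sumTo : ∀ n (a : ℤ) (f : ℕ → ℤ) → a * sumTo n f ≡ sumTo n (λ i → a * f i)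
*-distribˡ-sumTo zero    a f = ℤₚ.*-zeroʳ a
*-distribˡ-sumTo (suc n) a f = trans (ℤₚ.*-distribˡ-+ a (sumTo n f) (f n)) (cong (_+ a * f n) (*-distribˡ-sumTo n a f))

sumTo-sucˡ : ∀ n (f : ℕ → ℤ) → sumTo (suc n) f ≡ f 0 + sumTo n (λ i → f (suc i))
sumTo-sucˡ zero    f = ℤₚ.+-comm (+ 0) (f 0)
sumTo-sucˡ (suc n) f = trans (cong (_+ f (suc n)) (sumTo-sucˡ n f)) (ℤₚ.+-assoc (f 0) _ (f (suc n)))

homogeneous : ℤ → ℤ → ℕ → (ℕ → ℤ) → ℤ
homogeneous u v m f = sumTo (suc m) (λ i → f i * (u ^ i * v ^ (m ∸ i)))

homogeneous-vanishes : ∀ u v m {f : ℕ → ℤ} → (∀ i → f i ≡ + 0) → homogeneous u v m f ≡ + 0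
homogeneous-vanishes u v m f≗0 = sumTo-zero (suc m) (λ i → cong (_* (u ^ i * v ^ (m ∸ i))) (f≗0 i))

homogeneous-shift : ∀ u v m (f : ℕ → ℤ) → u * homogeneous u v m f ≡ homogeneous u v (suc m) (shift f)
homogeneous-shift u v m f = begin
  u * homogeneous u v m f
    ≡⟨ *-distribˡ-sumTo (suc m) u _ ⟩
  sumTo (suc m) (λ i → u * (f i * (u ^ i * v ^ (m ∸ i))))
    ≡⟨ sumTo-cong (suc m) (λ i _ → absorb-u (f i) (u ^ i) (v ^ (m ∸ i))) ⟩
  sumTo (suc m) (λ i → f i * (u ^ suc i * v ^ (m ∸ i)))
    ≡⟨ sym (ℤₚ.+-identityˡ _) ⟩
  + 0 + sumTo (suc m) (λ i → f i * (u ^ suc i * v ^ (m ∸ i)))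
    ≡⟨ sym (sumTo-sucˡ (suc m) _) ⟩
  homogeneous u v (suc m) (shift f)
    ∎
  where
  open ≡-Reasoning
  absorb-u : ∀ x U V → u * (x * (U * V)) ≡ x * ((u * U) * V)
  absorb-u x U V = trans (*-CS.x∙yz≈y∙xz u x (U * V)) (cong (x *_) (sym (ℤₚ.*-assoc u U V)))

homogeneous-raise : ∀ u v m (f : ℕ → ℤ) → f (suc m) ≡ + 0 → v * homogeneous u v m f ≡ homogeneous u v (suc m) f
homogeneous-raise u v m f f[1+m]≡0 = begin
  v * homogeneous u v m f
    ≡⟨ *-distribˡ-sumTo (suc m) v _ ⟩
  sumTo (suc m) (λ i → v * (f i * (u ^ i * v ^ (m ∸ i))))
    ≡⟨ sumTo-cong (suc m) (λ i i≤m → absorb-v (f i) (u ^ i) (m ∸ i) (sym (ℕₚ.+-∸-assoc 1 (ℕₚ.≤-pred i≤m)))) ⟩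
  sumTo (suc m) (λ i → f i * (u ^ i * v ^ (suc m ∸ i)))
    ≡⟨ sym (ℤₚ.+-identityʳ _) ⟩
  sumTo (suc m) (λ i → f i * (u ^ i * v ^ (suc m ∸ i))) + + 0
    ≡⟨ cong (λ t → sumTo (suc m) (λ i → f i * (u ^ i * v ^ (suc m ∸ i))) + t * (u ^ suc m * v ^ (suc m ∸ suc m)))
            (sym f[1+m]≡0) ⟩
  homogeneous u v (suc m) f
    ∎
  where
  open ≡-Reasoning
  absorb-v : ∀ x U k {k′} → suc k ≡ k′ → v * (x * (U * v ^ k)) ≡ x * (U * v ^ k′)
  absorb-v x U k refl = trans (*-CS.x∙yz≈y∙xz v x (U * v ^ k)) (cong (x *_) (*-CS.x∙yz≈y∙xz v U (v ^ k)))

lincomb : {A : Set} → (A → ℤ) → List (ℤ × A) → ℤ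
lincomb value []             = + 0
lincomb value ((a , x) ∷ ts) = a * value x + lincomb value ts

homogeneous-lincomb : ∀ u v m (ts : List (ℤ × ℤ × (ℕ → ℤ))) →
  All (λ { (_ , x , f) → x ≡ homogeneous u v m f }) ts →
  lincomb proj₁ ts ≡ homogeneous u v m (λ i → lincomb (λ { (_ , f) → f i }) ts)
homogeneous-lincomb u v m []                   []         = sym (homogeneous-vanishes u v m (λ _ → refl))
homogeneous-lincomb u v m ((a , x , f) ∷ ts) (x≡ ∷ ts≡) = begin
  a * x + lincomb proj₁ ts
    ≡⟨ cong₂ (λ s t → a * s + t) x≡ (homogeneous-lincomb u v m ts ts≡) ⟩
  a * homogeneous u v m f + homogeneous u v m g
    ≡⟨ cong (_+ homogeneous u v m g) (*-distribˡ-sumTo (suc m) a _) ⟩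
  sumTo (suc m) (λ i → a * (f i * w i)) + homogeneous u v m g
    ≡⟨ sumTo-+ (suc m) _ _ ⟩
  sumTo (suc m) (λ i → a * (f i * w i) + g i * w i)
    ≡⟨ sumTo-cong (suc m) (λ i _ → factor (f i) (g i) (w i)) ⟩
  homogeneous u v m (λ i → a * f i + g i)
    ∎
  where
  open ≡-Reasoning
  g : ℕ → ℤ
  g i = lincomb (λ { (_ , f) → f i }) ts
  w : ℕ → ℤ
  w i = u ^ i * v ^ (m ∸ i)
  factor : ∀ x y W → a * (x * W) + y * W ≡ (a * x + y) * W
  factor x y W = trans (cong (_+ y * W) (sym (ℤₚ.*-assoc a x W))) (sym (ℤₚ.*-distribʳ-+ W (a * x) y))

-- The operator L and the Schröder recurrences

L : (ε z : ℤ) → (ℕ → ℤ) → ℕ → ℤ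
L ε z F m = a₀ (+ m) * F m + a₁ ε z (+ m) * F (suc m) + a₂ (+ m) * F (suc (suc m))

largeS-homogeneous : ∀ k z → largeS k z ≡ homogeneous z (+ 1) k (largeCoeff k)
largeS-homogeneous k z = sumTo-cong (suc k) (λ i _ → cong (largeCoeff k i *_) (sym (
  trans (cong (z ^ i *_) (ℤₚ.^-zeroˡ (k ∸ i))) (ℤₚ.*-identityʳ (z ^ i)))))

largeS-recurrence : ∀ z k → L (+ 1) z (λ m → largeS m z) k ≡ + 0
largeS-recurrence z k = begin
  L (+ 1) z G k
    ≡⟨ regroup K z (G k) (G (suc k)) (G (suc (suc k))) ⟩
  lincomb proj₁ terms
    ≡⟨ homogeneous-lincomb z (+ 1) (suc (suc k)) terms (G₀ ∷ G₁ ∷ zG₁ ∷ G₂ ∷ []) ⟩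
  homogeneous z (+ 1) (suc (suc k)) (λ i → lincomb (λ { (_ , f) → f i }) terms)
    ≡⟨ homogeneous-vanishes z (+ 1) (suc (suc k)) (λ i → trans (regroup-coeffs K (c k i) (c (suc k) i)
                             (shift (c (suc k)) i) (c (suc (suc k)) i)) (largeCoeff-recurrence k i)) ⟩
  + 0
    ∎
  where
  open ≡-Reasoning
  K = + k
  G : ℕ → ℤ
  G m = largeS m z
  c = largeCoeff
  H : (ℕ → ℤ) → ℤ
  H = homogeneous z (+ 1) (suc (suc k))
  terms : List (ℤ × ℤ × (ℕ → ℤ))
  terms = (K , G k , c k) ∷ (- (+ 3 + + 2 * K) , G (suc k) , c (suc k))
        ∷ (- (+ 2 * (+ 3 + + 2 * K)) , z * G (suc k) , shift (c (suc k))) ∷ (+ 3 + K , G (suc (suc k)) , c (suc (suc k))) ∷ []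
  raise : ∀ m f → f (suc m) ≡ + 0 → homogeneous z (+ 1) m f ≡ homogeneous z (+ 1) (suc m) f
  raise m f f[1+m]≡0 = trans (sym (ℤₚ.*-identityˡ _)) (homogeneous-raise z (+ 1) m f f[1+m]≡0)
  G₀ : G k ≡ H (c k)
  G₀ = trans (largeS-homogeneous k z) (trans (raise k (c k) (largeCoeff-vanishes (ℕₚ.n<1+n k)))
                                             (raise (suc k) (c k) (largeCoeff-vanishes (ℕₚ.m<n⇒m<1+n (ℕₚ.n<1+n k)))))
  G₁ : G (suc k) ≡ H (c (suc k))
  G₁ = trans (largeS-homogeneous (suc k) z) (raise (suc k) (c (suc k)) (largeCoeff-vanishes (ℕₚ.n<1+n (suc k))))
  zG₁ : z * G (suc k) ≡ H (shift (c (suc k)))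
  zG₁ = trans (cong (z *_) (largeS-homogeneous (suc k) z)) (homogeneous-shift z (+ 1) (suc k) (c (suc k)))
  G₂ : G (suc (suc k)) ≡ H (c (suc (suc k)))
  G₂ = largeS-homogeneous (suc (suc k)) z
  regroup : ∀ K z G₀ G₁ G₂ →
    K * G₀ + (- (+ 1 * ((+ 2 * K + + 3) * (+ 1 + + 2 * z)))) * G₁ + (K + + 3) * G₂
      ≡ K * G₀ + ((- (+ 3 + + 2 * K)) * G₁ + ((- (+ 2 * (+ 3 + + 2 * K))) * (z * G₁) + ((+ 3 + K) * G₂ + + 0)))
  regroup = solve-∀
  regroup-coeffs : ∀ K c₀ c₁ s₁ c₂ →
    K * c₀ + ((- (+ 3 + + 2 * K)) * c₁ + ((- (+ 2 * (+ 3 + + 2 * K))) * s₁ + ((+ 3 + K) * c₂ + + 0)))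
      ≡ (+ 3 + K) * c₂ - (+ 3 + + 2 * K) * (c₁ + + 2 * s₁) + K * c₀
  regroup-coeffs = solve-∀

littleS-recurrence : ∀ z k → L (+ 1) z (λ m → littleS m z) k ≡ + 0
littleS-recurrence z zero = initial z
  where
  initial : ∀ z →
    + 0 * + 0 + (- (+ 1 * ((+ 2 * + 0 + + 3) * (+ 1 + + 2 * z)))) * (+ 0 + + 1 * (+ 1 * + 1))
      + (+ 0 + + 3) * ((+ 0 + + 1 * (+ 1 * ((z + + 1) * + 1))) + + 1 * ((z * + 1) * + 1)) ≡ + 0
  initial = solve-∀
-- With v = z + 1 we have 1 + 2z = z + v and 1 = (v − z)², which makes every term homogeneous of
-- degree q + 2 in z and v; littleS (suc m) z is by definition homogeneous z v m (littleCoeff m).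
littleS-recurrence z (suc q) = begin
  L (+ 1) z G (suc q)
    ≡⟨ regroup Q z (G (suc q)) (G (suc (suc q))) (G (suc (suc (suc q)))) ⟩
  lincomb proj₁ terms
    ≡⟨ homogeneous-lincomb z v (suc (suc q)) terms (refl ∷ zG₁ ∷ vG₁ ∷ vvG₀ ∷ zvG₀ ∷ zzG₀ ∷ []) ⟩
  homogeneous z v (suc (suc q)) (λ i → lincomb (λ { (_ , f) → f i }) terms)
    ≡⟨ homogeneous-vanishes z v (suc (suc q)) (λ i → trans (regroup-coeffs Q (e (suc (suc q)) i) (shift (e (suc q)) i)
         (e (suc q) i) (e q i) (shift (e q) i) (shift (shift (e q)) i)) (littleCoeff-recurrence q i)) ⟩
  + 0
    ∎
  where
  open ≡-Reasoning
  Q = + q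
  v = z + + 1
  G : ℕ → ℤ
  G m = littleS m z
  e = littleCoeff
  H : ℕ → (ℕ → ℤ) → ℤ
  H = homogeneous z v
  terms : List (ℤ × ℤ × (ℕ → ℤ))
  terms = (+ 4 + Q , G (suc (suc (suc q))) , e (suc (suc q)))
        ∷ (- (+ 5 + + 2 * Q) , z * G (suc (suc q)) , shift (e (suc q)))
        ∷ (- (+ 5 + + 2 * Q) , v * G (suc (suc q)) , e (suc q))
        ∷ (+ 1 + Q , v * (v * G (suc q)) , e q)
        ∷ (- (+ 2 * (+ 1 + Q)) , z * (v * G (suc q)) , shift (e q))
        ∷ (+ 1 + Q , z * (z * G (suc q)) , shift (shift (e q))) ∷ []
  zG₁ : z * H (suc q) (e (suc q)) ≡ H (suc (suc q)) (shift (e (suc q)))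
  zG₁ = homogeneous-shift z v (suc q) (e (suc q))
  vG₁ : v * H (suc q) (e (suc q)) ≡ H (suc (suc q)) (e (suc q))
  vG₁ = homogeneous-raise z v (suc q) (e (suc q)) (littleCoeff-vanishes (ℕₚ.n<1+n (suc q)))
  vG₀ : v * H q (e q) ≡ H (suc q) (e q)
  vG₀ = homogeneous-raise z v q (e q) (littleCoeff-vanishes (ℕₚ.n<1+n q))
  vvG₀ : v * (v * H q (e q)) ≡ H (suc (suc q)) (e q)
  vvG₀ = trans (cong (v *_) vG₀) (homogeneous-raise z v (suc q) (e q) (littleCoeff-vanishes (ℕₚ.m<n⇒m<1+n (ℕₚ.n<1+n q))))
  zvG₀ : z * (v * H q (e q)) ≡ H (suc (suc q)) (shift (e q))
  zvG₀ = trans (cong (z *_) vG₀) (homogeneous-shift z v (suc q) (e q))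
  zzG₀ : z * (z * H q (e q)) ≡ H (suc (suc q)) (shift (shift (e q)))
  zzG₀ = trans (cong (z *_) (homogeneous-shift z v q (e q))) (homogeneous-shift z v (suc q) (shift (e q)))
  regroup : ∀ Q z G₀ G₁ G₂ →
    (+ 1 + Q) * G₀ + (- (+ 1 * ((+ 2 * (+ 1 + Q) + + 3) * (+ 1 + + 2 * z)))) * G₁ + ((+ 1 + Q) + + 3) * G₂
      ≡ (+ 4 + Q) * G₂ + ((- (+ 5 + + 2 * Q)) * (z * G₁) + ((- (+ 5 + + 2 * Q)) * ((z + + 1) * G₁)
        + ((+ 1 + Q) * ((z + + 1) * ((z + + 1) * G₀)) + ((- (+ 2 * (+ 1 + Q))) * (z * ((z + + 1) * G₀))
        + ((+ 1 + Q) * (z * (z * G₀)) + + 0)))))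
  regroup = solve-∀
  regroup-coeffs : ∀ Q e₂ s₁ e₁ e₀ s₀ ss₀ →
    (+ 4 + Q) * e₂ + ((- (+ 5 + + 2 * Q)) * s₁ + ((- (+ 5 + + 2 * Q)) * e₁
      + ((+ 1 + Q) * e₀ + ((- (+ 2 * (+ 1 + Q))) * s₀ + ((+ 1 + Q) * ss₀ + + 0)))))
      ≡ (+ 4 + Q) * e₂ - (+ 5 + + 2 * Q) * (s₁ + e₁) + (+ 1 + Q) * (e₀ - + 2 * s₀ + ss₀)
  regroup-coeffs = solve-∀

L-twist : ∀ ε z (F G : ℕ → ℤ) → ε * ε ≡ + 1 → (∀ k → F k ≡ ε ^ k * G k) →
  ∀ m → L ε z F m ≡ ε ^ m * L (+ 1) z G m
L-twist ε z F G ε²≡1 F≡ m =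
  linear-combination₄ M (a₁ ε z M) (M + + 3) (ε ^ m * ((M + + 3) * G (suc (suc m)) - (+ 2 * M + + 3) * (+ 1 + + 2 * z) * G (suc m)))
    (certificate ε (ε ^ m) M z (F m) (F (suc m)) (F (suc (suc m))) (G m) (G (suc m)) (G (suc (suc m))))
    (F≡ m) (F≡ (suc m)) (F≡ (suc (suc m))) ε²≡1
  where
  M = + m
  certificate : ∀ ε E M z F₀ F₁ F₂ G₀ G₁ G₂ →
    M * F₀ + (- (ε * ((+ 2 * M + + 3) * (+ 1 + + 2 * z)))) * F₁ + (M + + 3) * F₂
      - E * (M * G₀ + (- (+ 1 * ((+ 2 * M + + 3) * (+ 1 + + 2 * z)))) * G₁ + (M + + 3) * G₂)
    ≡ M * (F₀ - E * G₀) + (- (ε * ((+ 2 * M + + 3) * (+ 1 + + 2 * z)))) * (F₁ - ε * E * G₁)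
      + (M + + 3) * (F₂ - ε * (ε * E) * G₂)
      + E * ((M + + 3) * G₂ - (+ 2 * M + + 3) * (+ 1 + + 2 * z) * G₁) * (ε * ε - + 1)
  certificate = solve-∀

-- The boundary term of summation by parts for L and L*.
concomitant : (ℤ → ℤ) → (ℕ → ℤ) → ℕ → ℤ
concomitant x F m = + m * x (+ m) * F m - (+ m + + 2) * x (+ m - + 1) * F (suc m)

Ladj-summation-by-parts : ∀ ε z (x : ℤ → ℤ) (F : ℕ → ℤ) → x (- + 1) ≡ + 0 → x (- + 2) ≡ + 0 →
  (∀ m → L ε z F m ≡ + 0) → ∀ m → sumTo (suc m) (λ k → Ladj ε z x (+ k) * F k) ≡ concomitant x F m
Ladj-summation-by-parts ε z x F x[-1]≡0 x[-2]≡0 LF≡0 zero =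
  linear-combination₂ (a₁ ε z (- + 1) * F 0 + + 2 * F 1) (+ 1 * F 0)
    (certificate (x (+ 0)) (x (- + 1)) (x (- + 2)) (a₁ ε z (- + 1)) (F 0) (F 1)) x[-1]≡0 x[-2]≡0
  where
  certificate : ∀ (X₀ X₋₁ X₋₂ A F₀ F₁ : ℤ) →
    (+ 0 + (+ 0 * X₀ + A * X₋₁ + ((+ 0 - + 2) + + 3) * X₋₂) * F₀) - (+ 0 * X₀ * F₀ - (+ 0 + + 2) * X₋₁ * F₁)
      ≡ (A * F₀ + + 2 * F₁) * (X₋₁ - + 0) + (+ 1 * F₀) * (X₋₂ - + 0)
  certificate = solve-∀
Ladj-summation-by-parts ε z x F x[-1]≡0 x[-2]≡0 LF≡0 (suc m) = begin
  sumTo (suc m) (λ k → Ladj ε z x (+ k) * F k) + Ladj ε z x (+ suc m) * F (suc m)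
    ≡⟨ cong₂ (λ s t → s + t * F (suc m)) (Ladj-summation-by-parts ε z x F x[-1]≡0 x[-2]≡0 LF≡0 m) Ladj-at-suc ⟩
  concomitant x F m + (+ suc m * x (+ suc m) + a₁ ε z M * x M + a₂ (M - + 1) * x (M - + 1)) * F (suc m)
    ≡⟨ linear-combination₁ (x M) (certificate M (x (+ suc m)) (x M) (x (M - + 1)) (a₁ ε z M) (F m) (F (suc m)) (F (suc (suc m))))
                           (LF≡0 m) ⟩
  concomitant x F (suc m)
    ∎
  where
  open ≡-Reasoning
  M = + m
  Ladj-at-suc : Ladj ε z x (+ suc m) ≡ + suc m * x (+ suc m) + a₁ ε z M * x M + a₂ (M - + 1) * x (M - + 1)
  Ladj-at-suc = cong (λ t → + suc m * x (+ suc m) + a₁ ε z M * x M + a₂ t * x t) (step-back M)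
    where
    step-back : ∀ M → (+ 1 + M) - + 2 ≡ M - + 1
    step-back = solve-∀
  certificate : ∀ (M X₁ X₀ X₋₁ A F₀ F₁ F₂ : ℤ) →
    (M * X₀ * F₀ - (M + + 2) * X₋₁ * F₁ + ((+ 1 + M) * X₁ + A * X₀ + ((M - + 1) + + 3) * X₋₁) * F₁)
      - ((+ 1 + M) * X₁ * F₁ - ((+ 1 + M) + + 2) * X₀ * F₂)
    ≡ X₀ * ((M * F₀ + A * F₁ + (M + + 3) * F₂) - + 0)
  certificate = solve-∀

xs2-at-−1 : ∀ s → xs2 s (- + 1) ≡ + 0
xs2-at-−1 s = cong (_* + 1) (ℤₚ.*-zeroʳ (+ 2 * ((+ 2 * - + 1 + + 3) ^ s)))

xs2-at-−2 : ∀ s → xs2 s (- + 2) ≡ + 0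
xs2-at-−2 s = ℤₚ.*-zeroʳ (+ 2 * ((+ 2 * - + 2 + + 3) ^ s) * - + 1)

concomitant-xs2-divisible : ∀ s (F : ℕ → ℤ) m →
  + (2 ℕ.* suc m ℕ.* (suc m ℕ.* suc m ∸ 1)) ∣ concomitant (xs2 s) F m
concomitant-xs2-divisible s F m = Signed.∣⇒∣ᵤ (Signed.divides (Q * F m - P * F (suc m)) (begin
  concomitant (xs2 s) F m
    ≡⟨ certificate M Q P (F m) (F (suc m)) ⟩
  (Q * F m - P * F (suc m)) * (+ 2 * (+ 1 + M) * (M + M * (+ 1 + M)))
    ≡⟨ cong ((Q * F m - P * F (suc m)) *_) (sym divisor) ⟩
  (Q * F m - P * F (suc m)) * + (2 ℕ.* suc m ℕ.* (suc m ℕ.* suc m ∸ 1))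
    ∎))
  where
  open ≡-Reasoning
  M = + m
  Q = (+ 2 * M + + 3) ^ s
  P = (+ 2 * (M - + 1) + + 3) ^ s
  certificate : ∀ (M Q P F₀ F₁ : ℤ) →
    M * (+ 2 * Q * (M + + 1) * (M + + 2)) * F₀ - (M + + 2) * (+ 2 * P * ((M - + 1) + + 1) * ((M - + 1) + + 2)) * F₁
      ≡ (Q * F₀ - P * F₁) * (+ 2 * (+ 1 + M) * (M + M * (+ 1 + M)))
  certificate = solve-∀
  divisor : + (2 ℕ.* suc m ℕ.* (suc m ℕ.* suc m ∸ 1)) ≡ + 2 * (+ 1 + M) * (M + M * (+ 1 + M))
  divisor = trans (ℤₚ.pos-* (2 ℕ.* suc m) _) (cong₂ _*_ (ℤₚ.pos-* 2 (suc m)) (cong (λ t → M + t) (ℤₚ.pos-* m (suc m))))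

±1-squared : ∀ {ε} → ε ≡ + 1 ⊎ ε ≡ - + 1 → ε * ε ≡ + 1
±1-squared (inj₁ refl) = refl
±1-squared (inj₂ refl) = refl

twisted-Ladj-sum-divisible : ∀ ε z s (G F : ℕ → ℤ) → ε * ε ≡ + 1 → (∀ k → L (+ 1) z G k ≡ + 0) →
  (∀ k → F k ≡ ε ^ k * G k) →
  ∀ n → + (2 ℕ.* n ℕ.* (n ℕ.* n ∸ 1)) ∣ sumTo n (λ k → Ladj ε z (xs2 s) (+ k) * F k)
twisted-Ladj-sum-divisible ε z s G F ε²≡1 LG≡0 F≡ zero = 0 ∣0
twisted-Ladj-sum-divisible ε z s G F ε²≡1 LG≡0 F≡ (suc m) =
  subst (+ (2 ℕ.* suc m ℕ.* (suc m ℕ.* suc m ∸ 1)) ∣_)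
    (sym (Ladj-summation-by-parts ε z (xs2 s) F (xs2-at-−1 s) (xs2-at-−2 s) LF≡0 m))
    (concomitant-xs2-divisible s F m)
  where
  LF≡0 : ∀ k → L ε z F k ≡ + 0
  LF≡0 k = trans (L-twist ε z F G ε²≡1 F≡ k) (trans (cong (ε ^ k *_) (LG≡0 k)) (ℤₚ.*-zeroʳ (ε ^ k)))

corollary3p3 : (ε : ℤ) → (ε ≡ + 1 ⊎ ε ≡ - + 1) →
    (F : ℕ → ℤ → ℤ) →
    ((∀ k z → F k z ≡ (ε ^ k) * largeS k z) ⊎ (∀ k z → F k z ≡ (ε ^ k) * littleS k z)) →
    (z : ℤ) → (n s : ℕ) → n > 1 →
    (+ (2 ℕ.* n ℕ.* (n ℕ.* n ℕ.∸ 1))) ∣ sumTo n (λ k → Ladj ε z (xs2 s) (+ k) * F k z)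
corollary3p3 ε ε≡±1 F (inj₁ F≡) z n s _ =
  twisted-Ladj-sum-divisible ε z s (λ k → largeS k z) (λ k → F k z) (±1-squared ε≡±1) (largeS-recurrence z) (λ k → F≡ k z) n
corollary3p3 ε ε≡±1 F (inj₂ F≡) z n s _ =
  twisted-Ladj-sum-divisible ε z s (λ k → littleS k z) (λ k → F k z) (±1-squared ε≡±1) (littleS-recurrence z) (λ k → F≡ k z) n
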